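{- Let $d,k\in\mathbb{N}$, $t=2k-1$, and consider the grid $[t]^d=\{1,\dots,t\}^d\subset\mathbb{Z}^d$. If $\ell_1$ and $\ell_2$ are distinct lines in $\mathbb{R}^d$ each of which contains $t$ points of $[t]^d$, then $\ell_1\cap\ell_2$ is either empty or a single point of $[t]^d$.
   Formalization: The lines $\ell_1$ and $\ell_2$ are taken in ℚ^d rather than ℝ^d: their base points, directions and parameters are rational, and only their rational points are considered. -}

module Defs where

open import Data.Nat using (ℕ; _≤_; _∸_; _*_)
open import Data.Integer using (+_)
open import Data.Rational using (ℚ; _/_; 0ℚ) renaming (_+_ to _+ℚ_; _*_ to _*ℚ_)
open import Data.Fin using (Fin)
open import Data.Vec using (Vec; lookup)
open import Data.Product using (Σ; ∃; _×_)
open import Relation.Binary.PropositionalEquality using (_≡_)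
open import Relation.Nullary using (¬_)
open import Function.Definitions using (Injective)

Point : ℕ → Set
Point d = Vec ℚ d

ℕ→ℚ : ℕ → ℚ
ℕ→ℚ n = + n / 1

InGrid : (t : ℕ) {d : ℕ} → Point d → Set
InGrid t {d} x = (i : Fin d) → Σ ℕ λ n → (1 ≤ n) × (n ≤ t) × (lookup x i ≡ ℕ→ℚ n)

record Line (d : ℕ) : Set where
  field
    base : Point d
    dir  : Point d
    dir≢0 : ¬ ((i : Fin d) → lookup dir i ≡ 0ℚ)

open Line public

_∈L_ : {d : ℕ} → Point d → Line d → Set
_∈L_ {d} x ℓ = Σ ℚ λ λ′ → (i : Fin d) → lookup x i ≡ lookup (base ℓ) i +ℚ λ′ *ℚ lookup (dir ℓ) i

SameLine : {d : ℕ} → Line d → Line d → Set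
SameLine {d} ℓ₁ ℓ₂ = (x : Point d) → (x ∈L ℓ₁ → x ∈L ℓ₂) × (x ∈L ℓ₂ → x ∈L ℓ₁)

ContainsGridPoints : (t : ℕ) {d : ℕ} → Line d → Set
ContainsGridPoints t {d} ℓ =
  Σ (Fin t → Point d) λ f → Injective _≡_ _≡_ f × ((j : Fin t) → InGrid t (f j) × (f j ∈L ℓ))

{-# OPTIONS --safe #-}
-- Let ℓ contain t ≥ 2 points of [t]^d. Along ℓ each coordinate is either constant or takes t distinct
-- values in {1,…,t}, hence all of them, so at the two extreme grid points of ℓ every moving coordinate
-- is 1 at one end and t at the other. Parametrising ℓ by s so that these ends sit at s = 1 and s = t
-- makes ℓ a geometric line in the sense of Hales–Jewett: every coordinate is a constant in [t], s, or
-- t + 1 − s, and s runs through {1,…,t} on the grid points.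
--
-- Let x lie on two distinct such lines, with parameters u and w. A moving coordinate of the first line
-- either pins u to a grid value or forces w = u or w = t + 1 − u. As the lines differ, some coordinate
-- violates this relation, and each way of violating it forces u ∈ {1,…,t}; the last one is
-- u = t + 1 − u, i.e. u = k, which is where t = 2k − 1 is used. So x ∈ [t]^d. Two distinct lines share
-- at most one point, since two points determine a line, and for t = 1 the grid [1]^d is a single point.
module Submission where

open import Defs
open import Data.Bool using (Bool; true; false; _xor_)
import Data.Bool.Properties as Bool
open import Data.Fin as Fin using (Fin; toℕ; fromℕ<; punchOut)
import Data.Fin.Properties as Fin
open import Data.Integer as ℤ using (+_; +≤+)
import Data.Integer.Properties as ℤ
open import Data.List using (allFin)
open import Data.List.Membership.Propositional.Properties using (∈-allFin)
import Data.List.Relation.Unary.All as All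
import Data.List.Extrema
open import Data.Nat as ℕ using (ℕ; zero; suc; _≤_; _∸_; _*_; z≤n; s≤s)
import Data.Nat.Properties as ℕ
import Data.Nat.Coprimality as Coprimality
open import Data.Product using (Σ; ∃; _×_; _,_; proj₁; proj₂)
open import Data.Rational as ℚ
  using (ℚ; mkℚ; 0ℚ; 1ℚ; ½; _+_; _-_; -_; 1/_; _÷_; NonZero; *≤*; toℚᵘ; fromℚᵘ)
  renaming (_*_ to _·_)
import Data.Rational.Properties as ℚ
import Data.Rational.Unnormalised as ℚᵘ
import Data.Rational.Unnormalised.Properties as ℚᵘ
open import Data.Rational.Solver using (module +-*-Solver)
open import Data.Sum using (_⊎_; inj₁; inj₂; [_,_]′)
open import Data.Vec using (lookup)
import Data.Vec.Properties as Vec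
open import Data.Vec.Relation.Binary.Pointwise.Extensional using (ext; Pointwise-≡⇒≡)
open import Function using (_∘_; id)
open import Function.Definitions using (Injective)
open import Relation.Binary using (DecTotalOrder; Tri; tri<; tri≈; tri>)
open import Relation.Binary.PropositionalEquality
open import Relation.Nullary using (¬_; yes; no; contradiction)

open +-*-Solver using (solve; _:=_; _:+_; _:*_; _:-_; :-_; con)
open ≡-Reasoning

ℕ→ℚ≡mkℚ : ∀ n → ℕ→ℚ n ≡ mkℚ (+ n) 0 (Coprimality.sym (Coprimality.1-coprimeTo n))
ℕ→ℚ≡mkℚ n = ℚ.normalize-coprime (Coprimality.sym (Coprimality.1-coprimeTo n))

ℕ→ℚ-+ : ∀ m n → ℕ→ℚ (m ℕ.+ n) ≡ ℕ→ℚ m + ℕ→ℚ n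
ℕ→ℚ-+ m n = begin
  ℕ→ℚ (m ℕ.+ n)                             ≡⟨⟩
  fromℚᵘ (ℚᵘ.mkℚᵘ (+ (m ℕ.+ n)) 0)           ≡⟨ ℚ.fromℚᵘ-cong sumᵘ ⟩
  fromℚᵘ (toℚᵘ (ℕ→ℚ m) ℚᵘ.+ toℚᵘ (ℕ→ℚ n))   ≡⟨ ℚ.fromℚᵘ-cong (ℚᵘ.≃-sym (ℚ.toℚᵘ-homo-+ (ℕ→ℚ m) (ℕ→ℚ n))) ⟩
  fromℚᵘ (toℚᵘ (ℕ→ℚ m + ℕ→ℚ n))             ≡⟨ ℚ.fromℚᵘ-toℚᵘ _ ⟩
  ℕ→ℚ m + ℕ→ℚ n                             ∎
  where
  sumᵘ : ℚᵘ.mkℚᵘ (+ (m ℕ.+ n)) 0 ℚᵘ.≃ toℚᵘ (ℕ→ℚ m) ℚᵘ.+ toℚᵘ (ℕ→ℚ n)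
  sumᵘ rewrite ℕ→ℚ≡mkℚ m | ℕ→ℚ≡mkℚ n = ℚᵘ.*≡* (begin
    + (m ℕ.+ n) ℤ.* + 1                       ≡⟨ ℤ.*-identityʳ _ ⟩
    + m ℤ.+ + n                               ≡⟨ sym (cong₂ ℤ._+_ (ℤ.*-identityʳ (+ m)) (ℤ.*-identityʳ (+ n))) ⟩
    + m ℤ.* + 1 ℤ.+ + n ℤ.* + 1               ≡⟨ sym (ℤ.*-identityʳ _) ⟩
    (+ m ℤ.* + 1 ℤ.+ + n ℤ.* + 1) ℤ.* + 1     ∎)

ℕ→ℚ-suc : ∀ n → ℕ→ℚ (suc n) ≡ 1ℚ + ℕ→ℚ n
ℕ→ℚ-suc = ℕ→ℚ-+ 1

ℕ→ℚ-2* : ∀ n → ℕ→ℚ (2 * n) ≡ ℕ→ℚ n + ℕ→ℚ n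
ℕ→ℚ-2* n = trans (ℕ→ℚ-+ n (n ℕ.+ 0)) (cong (λ m → ℕ→ℚ n + ℕ→ℚ m) (ℕ.+-identityʳ n))

ℕ→ℚ-∸ : ∀ {m n} → n ≤ m → ℕ→ℚ (m ∸ n) ≡ ℕ→ℚ m - ℕ→ℚ n
ℕ→ℚ-∸ {m} {n} n≤m = begin
  ℕ→ℚ (m ∸ n)                      ≡⟨ solve 2 (λ a b → a := a :+ b :- b) refl (ℕ→ℚ (m ∸ n)) (ℕ→ℚ n) ⟩
  ℕ→ℚ (m ∸ n) + ℕ→ℚ n - ℕ→ℚ n      ≡⟨ cong (_- ℕ→ℚ n) (sym (ℕ→ℚ-+ (m ∸ n) n)) ⟩
  ℕ→ℚ (m ∸ n ℕ.+ n) - ℕ→ℚ n        ≡⟨ cong (λ k → ℕ→ℚ k - ℕ→ℚ n) (ℕ.m∸n+n≡m n≤m) ⟩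
  ℕ→ℚ m - ℕ→ℚ n                    ∎

ℕ→ℚ-mono-≤ : ∀ {m n} → m ≤ n → ℕ→ℚ m ℚ.≤ ℕ→ℚ n
ℕ→ℚ-mono-≤ {m} {n} m≤n rewrite ℕ→ℚ≡mkℚ m | ℕ→ℚ≡mkℚ n =
  *≤* (subst₂ ℤ._≤_ (sym (ℤ.*-identityʳ (+ m))) (sym (ℤ.*-identityʳ (+ n))) (+≤+ m≤n))

ℕ→ℚ-injective : Injective _≡_ _≡_ ℕ→ℚ
ℕ→ℚ-injective {m} {n} e = ℤ.+-injective (cong ℚ.↥_ (begin
  mkℚ (+ m) 0 _  ≡⟨ sym (ℕ→ℚ≡mkℚ m) ⟩
  ℕ→ℚ m          ≡⟨ e ⟩
  ℕ→ℚ n          ≡⟨ ℕ→ℚ≡mkℚ n ⟩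
  mkℚ (+ n) 0 _  ∎))

+-*-cancelʳ : ∀ {p a b} v .{{_ : NonZero v}} → p + a · v ≡ p + b · v → a ≡ b
+-*-cancelʳ {p} {a} {b} v e = begin
  a                     ≡⟨ sym (solve-for a) ⟩
  (p + a · v - p) ÷ v   ≡⟨ cong (λ y → (y - p) ÷ v) e ⟩
  (p + b · v - p) ÷ v   ≡⟨ solve-for b ⟩
  b                     ∎
  where
  solve-for : ∀ x → (p + x · v - p) ÷ v ≡ x
  solve-for x = begin
    (p + x · v - p) · 1/ v  ≡⟨ solve 4 (λ p x v w → (p :+ x :* v :- p) :* w := x :* (v :* w))
                                       refl p x v (1/ v) ⟩
    x · (v · 1/ v)          ≡⟨ cong (x ·_) (ℚ.*-inverseʳ v) ⟩
    x · 1ℚ                  ≡⟨ ℚ.*-identityʳ x ⟩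
    x                       ∎

p≢q⇒q-p≢0 : ∀ {p q} → p ≢ q → q - p ≢ 0ℚ
p≢q⇒q-p≢0 {p} {q} p≢q q-p≡0 = p≢q (begin
  p              ≡⟨ solve 2 (λ p q → p := :- (q :- p) :+ q) refl p q ⟩
  - (q - p) + q  ≡⟨ cong (λ y → - y + q) q-p≡0 ⟩
  0ℚ + q         ≡⟨ ℚ.+-identityˡ q ⟩
  q              ∎)

a+[c-a]÷[b-a]·[b-a]≡c : ∀ {a b} c (a≢b : a ≢ b) →
  let instance _ = ℚ.≢-nonZero (p≢q⇒q-p≢0 a≢b) in a + (c - a) ÷ (b - a) · (b - a) ≡ c
a+[c-a]÷[b-a]·[b-a]≡c {a} {b} c a≢b = begin
  a + (c - a) · 1/ (b - a) · (b - a)    ≡⟨ cong (λ y → a + y) (ℚ.*-assoc (c - a) _ (b - a)) ⟩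
  a + (c - a) · (1/ (b - a) · (b - a))  ≡⟨ cong (λ y → a + (c - a) · y) (ℚ.*-inverseˡ (b - a)) ⟩
  a + (c - a) · 1ℚ                      ≡⟨ solve 2 (λ a c → a :+ (c :- a) :* con 1ℚ := c) refl a c ⟩
  c                                     ∎
  where instance _ = ℚ.≢-nonZero (p≢q⇒q-p≢0 a≢b)

GridValue : ℕ → ℚ → Set
GridValue t q = Σ ℕ λ n → (1 ≤ n) × (n ≤ t) × (q ≡ ℕ→ℚ n)

1≤gridValue : ∀ {t q} → GridValue t q → 1ℚ ℚ.≤ q
1≤gridValue (n , 1≤n , _ , refl) = ℕ→ℚ-mono-≤ 1≤n

gridValue≤t : ∀ {t q} → GridValue t q → q ℚ.≤ ℕ→ℚ t
gridValue≤t (n , _ , n≤t , refl) = ℕ→ℚ-mono-≤ n≤t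

mirror : ℕ → ℚ → ℚ
mirror t q = 1ℚ + ℕ→ℚ t - q

mirror-involutive : ∀ t q → mirror t (mirror t q) ≡ q
mirror-involutive t = solve 2 (λ T q → con 1ℚ :+ T :- (con 1ℚ :+ T :- q) := q) refl (ℕ→ℚ t)

mirror-1 : ∀ t → mirror t 1ℚ ≡ ℕ→ℚ t
mirror-1 t = solve 1 (λ T → con 1ℚ :+ T :- con 1ℚ := T) refl (ℕ→ℚ t)

mirror-t : ∀ t → mirror t (ℕ→ℚ t) ≡ 1ℚ
mirror-t t = solve 1 (λ T → con 1ℚ :+ T :- T := con 1ℚ) refl (ℕ→ℚ t)

mirror-grid : ∀ {t q} → GridValue t q → GridValue t (mirror t q)
mirror-grid {t} (n , 1≤n , n≤t , refl) =
  suc t ∸ n , ℕ.m<n⇒0<n∸m (s≤s n≤t) , ℕ.∸-monoʳ-≤ (suc t) 1≤n , (begin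
    1ℚ + ℕ→ℚ t - ℕ→ℚ n   ≡⟨ cong (_- ℕ→ℚ n) (sym (ℕ→ℚ-suc t)) ⟩
    ℕ→ℚ (suc t) - ℕ→ℚ n  ≡⟨ sym (ℕ→ℚ-∸ (ℕ.m≤n⇒m≤1+n n≤t)) ⟩
    ℕ→ℚ (suc t ∸ n)      ∎)

orient : ℕ → Bool → ℚ → ℚ
orient t false q = q
orient t true  q = mirror t q

orient-involutive : ∀ {t} b {q} → orient t b (orient t b q) ≡ q
orient-involutive     false = refl
orient-involutive {t} true  = mirror-involutive t _

orient-xor : ∀ {t} b c q → orient t b (orient t c q) ≡ orient t (b xor c) q
orient-xor     false c     q = refl
orient-xor     true  false q = refl
orient-xor {t} true  true  q = mirror-involutive t q

orient-injective : ∀ {t} b → Injective _≡_ _≡_ (orient t b)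
orient-injective {t} b e =
  trans (sym (orient-involutive b)) (trans (cong (orient t b) e) (orient-involutive b))

orient-grid : ∀ {t q} b → GridValue t q → GridValue t (orient t b q)
orient-grid false = id
orient-grid true  = mirror-grid

orient⁻¹-grid : ∀ {t u q} b → orient t b u ≡ q → GridValue t q → GridValue t u
orient⁻¹-grid {t} b e g =
  subst (GridValue t) (trans (cong (orient t b) (sym e)) (orient-involutive b)) (orient-grid b g)

orient-fixedPoint : ∀ {t b c u} → b ≢ c → orient t b u ≡ orient t c u → u ≡ mirror t u
orient-fixedPoint {b = false} {false} b≢c _ = contradiction refl b≢c
orient-fixedPoint {b = false} {true}  _   e = e
orient-fixedPoint {b = true}  {false} _   e = sym e
orient-fixedPoint {b = true}  {true}  b≢c _ = contradiction refl b≢c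

data Letter (t : ℕ) : Set where
  fixed  : (c : ℚ) → GridValue t c → Letter t
  moving : (reversed : Bool) → Letter t

_⟦_⟧ : ∀ {t} → Letter t → ℚ → ℚ
fixed c _        ⟦ s ⟧ = c
_⟦_⟧ {t} (moving b) s = orient t b s

letter-grid : ∀ {t s} (a : Letter t) → GridValue t s → GridValue t (a ⟦ s ⟧)
letter-grid (fixed c g) _ = g
letter-grid (moving b)  g = orient-grid b g

letter-affine : ∀ {t} (a : Letter t) r →
  a ⟦ 1ℚ + r · (ℕ→ℚ t - 1ℚ) ⟧ ≡ a ⟦ 1ℚ ⟧ + r · (a ⟦ ℕ→ℚ t ⟧ - a ⟦ 1ℚ ⟧)
letter-affine     (fixed c _)    r = solve 2 (λ c r → c := c :+ r :* (c :- c)) refl c r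
letter-affine     (moving false) r = refl
letter-affine {t} (moving true)  r = solve 2
  (λ T r → con 1ℚ :+ T :- (con 1ℚ :+ r :* (T :- con 1ℚ))
         := (con 1ℚ :+ T :- con 1ℚ) :+ r :* ((con 1ℚ :+ T :- T) :- (con 1ℚ :+ T :- con 1ℚ)))
  refl (ℕ→ℚ t) r

_⟦_⟧≡_ : ∀ {t d} → (Fin d → Letter t) → ℚ → Point d → Set
word ⟦ s ⟧≡ x = ∀ i → lookup x i ≡ word i ⟦ s ⟧

record GeometricLine (t : ℕ) {d : ℕ} (ℓ : Line d) : Set where
  field
    word         : Fin d → Letter t
    movingLetter : Σ (Fin d) λ i → Σ Bool λ b → word i ≡ moving b
    ∈L⇒word      : ∀ {x} → x ∈L ℓ → Σ ℚ λ s → word ⟦ s ⟧≡ x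
    word⇒∈L      : ∀ {x s} → word ⟦ s ⟧≡ x → x ∈L ℓ

record Through {d} (x y z : Point d) : Set where
  constructor _,_
  field
    ratio  : ℚ
    coords : ∀ i → lookup z i ≡ lookup x i + ratio · (lookup y i - lookup x i)

affine-combination : ∀ p v a b r → p + (a + r · (b - a)) · v ≡ p + a · v + r · (p + b · v - (p + a · v))
affine-combination = solve 5 (λ p v a b r →
  p :+ (a :+ r :* (b :- a)) :* v := p :+ a :* v :+ r :* (p :+ b :* v :- (p :+ a :* v))) refl

module _ {d} (ℓ : Line d) {x y : Point d} where
  private
    p v : Fin d → ℚ
    p i = lookup (base ℓ) i
    v i = lookup (dir ℓ) i

  through⇒∈L : x ∈L ℓ → y ∈L ℓ → ∀ {z} → Through x y z → z ∈L ℓ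
  through⇒∈L (a , x≡) (b , y≡) {z} (r , z≡) = a + r · (b - a) , λ i → begin
    lookup z i                                  ≡⟨ z≡ i ⟩
    lookup x i + r · (lookup y i - lookup x i)  ≡⟨ cong₂ (λ X Y → X + r · (Y - X)) (x≡ i) (y≡ i) ⟩
    p i + a · v i + r · (p i + b · v i - (p i + a · v i))
                                                ≡⟨ sym (affine-combination (p i) (v i) a b r) ⟩
    p i + (a + r · (b - a)) · v i               ∎

  ∈L⇒through : x ≢ y → x ∈L ℓ → y ∈L ℓ → ∀ z → z ∈L ℓ → Through x y z
  ∈L⇒through x≢y (a , x≡) (b , y≡) z (c , z≡) = r , λ i → begin
    lookup z i                                  ≡⟨ z≡ i ⟩
    p i + c · v i                               ≡⟨ cong (λ μ → p i + μ · v i) (sym (a+[c-a]÷[b-a]·[b-a]≡c c a≢b)) ⟩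
    p i + (a + r · (b - a)) · v i               ≡⟨ affine-combination (p i) (v i) a b r ⟩
    p i + a · v i + r · (p i + b · v i - (p i + a · v i))
                                                ≡⟨ cong₂ (λ X Y → X + r · (Y - X)) (sym (x≡ i)) (sym (y≡ i)) ⟩
    lookup x i + r · (lookup y i - lookup x i)  ∎
    where
    a≢b : a ≢ b
    a≢b refl = x≢y (Pointwise-≡⇒≡ (ext λ i → trans (x≡ i) (sym (y≡ i))))
    instance _ = ℚ.≢-nonZero (p≢q⇒q-p≢0 a≢b)
    r = (c - a) ÷ (b - a)

lines-meet-at-most-once : ∀ {d} (ℓ₁ ℓ₂ : Line d) → ¬ SameLine ℓ₁ ℓ₂ →
  (x y : Point d) → x ∈L ℓ₁ → x ∈L ℓ₂ → y ∈L ℓ₁ → y ∈L ℓ₂ → x ≡ y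
lines-meet-at-most-once ℓ₁ ℓ₂ ¬same x y x∈ℓ₁ x∈ℓ₂ y∈ℓ₁ y∈ℓ₂ with Vec.≡-dec ℚ._≟_ x y
... | yes x≡y = x≡y
... | no  x≢y = contradiction (λ z →
        (λ z∈ℓ₁ → through⇒∈L ℓ₂ x∈ℓ₂ y∈ℓ₂ (∈L⇒through ℓ₁ x≢y x∈ℓ₁ y∈ℓ₁ z z∈ℓ₁)) ,
        (λ z∈ℓ₂ → through⇒∈L ℓ₁ x∈ℓ₁ y∈ℓ₁ (∈L⇒through ℓ₂ x≢y x∈ℓ₂ y∈ℓ₂ z z∈ℓ₂))) ¬same

injective⇒surjective : ∀ {n} {f : Fin n → Fin n} → Injective _≡_ _≡_ f → ∀ y → ∃ λ x → f x ≡ y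
injective⇒surjective {suc n} {f} f-injective y with Fin.any? (λ x → f x Fin.≟ y)
... | yes hit = hit
... | no  miss = contradiction (Fin.injective⇒≤ g-injective) ℕ.1+n≰n
  where
  y≢f : ∀ x → y ≢ f x
  y≢f x y≡fx = miss (x , sym y≡fx)
  g : Fin (suc n) → Fin n
  g x = punchOut (y≢f x)
  g-injective : Injective _≡_ _≡_ g
  g-injective gx≡gx′ = f-injective (Fin.punchOut-injective (y≢f _) (y≢f _) gx≡gx′)

gridIndex : ∀ {t q} → GridValue t q → Fin t
gridIndex (suc m , _ , m<t , _) = fromℕ< m<t

gridIndex-value : ∀ {t q} (g : GridValue t q) → q ≡ ℕ→ℚ (suc (toℕ (gridIndex g)))
gridIndex-value (suc m , _ , m<t , q≡m) = trans q≡m (cong (ℕ→ℚ ∘ suc) (sym (Fin.toℕ-fromℕ< m<t)))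

module DistinctGridValues {n} (g : Fin (suc n) → ℚ) (grid : ∀ j → GridValue (suc n) (g j))
                          (g-injective : Injective _≡_ _≡_ g) where

  exhaustive : ∀ c → ∃ λ j → g j ≡ ℕ→ℚ (suc (toℕ c))
  exhaustive c =
    let (j , index-j≡c) = injective⇒surjective index-injective c in
    j , trans (gridIndex-value (grid j)) (cong (ℕ→ℚ ∘ suc ∘ toℕ) index-j≡c)
    where
    index : Fin (suc n) → Fin (suc n)
    index j = gridIndex (grid j)
    index-injective : Injective _≡_ _≡_ index
    index-injective {j} {j′} e = g-injective (begin
      g j                            ≡⟨ gridIndex-value (grid j) ⟩
      ℕ→ℚ (suc (toℕ (index j)))      ≡⟨ cong (ℕ→ℚ ∘ suc ∘ toℕ) e ⟩
      ℕ→ℚ (suc (toℕ (index j′)))     ≡⟨ sym (gridIndex-value (grid j′)) ⟩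
      g j′                           ∎)

  minimum≡1 : ∀ {j₀} → (∀ j → g j₀ ℚ.≤ g j) → g j₀ ≡ 1ℚ
  minimum≡1 {j₀} g₀≤ =
    let (j₁ , g₁≡1) = exhaustive Fin.zero in
    ℚ.≤-antisym (subst (g j₀ ℚ.≤_) g₁≡1 (g₀≤ j₁)) (1≤gridValue (grid j₀))

  maximum≡t : ∀ {j₀} → (∀ j → g j ℚ.≤ g j₀) → g j₀ ≡ ℕ→ℚ (suc n)
  maximum≡t {j₀} ≤g₀ =
    let (jₜ , gₜ≡t) = exhaustive (Fin.fromℕ n) in
    ℚ.≤-antisym (gridValue≤t (grid j₀))
                (subst (ℚ._≤ g j₀) (trans gₜ≡t (cong (ℕ→ℚ ∘ suc) (Fin.toℕ-fromℕ n))) (≤g₀ jₜ))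

module GridLine {n d} (ℓ : Line d) (points : ContainsGridPoints (suc (suc n)) ℓ) where
  open Data.List.Extrema (DecTotalOrder.totalOrder ℚ.≤-decTotalOrder)

  private
    t : ℕ
    t = suc (suc n)
    T : ℚ
    T = ℕ→ℚ t
    p v : Fin d → ℚ
    p i = lookup (base ℓ) i
    v i = lookup (dir ℓ) i
    f : Fin t → Point d
    f = proj₁ points
    f-injective : Injective _≡_ _≡_ f
    f-injective = proj₁ (proj₂ points)
    grid : ∀ j → InGrid t (f j)
    grid j = proj₁ (proj₂ (proj₂ points) j)
    on : ∀ j → f j ∈L ℓ
    on j = proj₂ (proj₂ (proj₂ points) j)
    λ′ : Fin t → ℚ
    λ′ j = proj₁ (on j)
    coord : Fin d → Fin t → ℚ
    coord i j = lookup (f j) i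
    coord≡ : ∀ i j → coord i j ≡ p i + λ′ j · v i
    coord≡ i j = proj₂ (on j) i

  jmin jmax : Fin t
  jmin = argmin λ′ Fin.zero (allFin t)
  jmax = argmax λ′ Fin.zero (allFin t)

  λmin≤ : ∀ j → λ′ jmin ℚ.≤ λ′ j
  λmin≤ j = All.lookup (f[argmin]≤f[xs] {f = λ′} Fin.zero (allFin t)) (∈-allFin j)

  ≤λmax : ∀ j → λ′ j ℚ.≤ λ′ jmax
  ≤λmax j = All.lookup (f[xs]≤f[argmax] {f = λ′} Fin.zero (allFin t)) (∈-allFin j)

  coord-injective : ∀ i → v i ≢ 0ℚ → Injective _≡_ _≡_ (coord i)
  coord-injective i v≢0 {j} {j′} e = f-injective (Pointwise-≡⇒≡ (ext λ i′ → begin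
    coord i′ j                ≡⟨ coord≡ i′ j ⟩
    p i′ + λ′ j · v i′        ≡⟨ cong (λ μ → p i′ + μ · v i′) λj≡λj′ ⟩
    p i′ + λ′ j′ · v i′       ≡⟨ sym (coord≡ i′ j′) ⟩
    coord i′ j′               ∎))
    where
    instance _ = ℚ.≢-nonZero v≢0
    λj≡λj′ : λ′ j ≡ λ′ j′
    λj≡λj′ = +-*-cancelʳ {p i} (v i) (trans (sym (coord≡ i j)) (trans e (coord≡ i j′)))

  coord-constant : ∀ i → v i ≡ 0ℚ → ∀ j j′ → coord i j ≡ coord i j′
  coord-constant i v≡0 j j′ = begin
    coord i j            ≡⟨ coord≡ i j ⟩
    p i + λ′ j · v i     ≡⟨ cong (λ w → p i + λ′ j · w) v≡0 ⟩
    p i + λ′ j · 0ℚ      ≡⟨ solve 3 (λ p a b → p :+ a :* con 0ℚ := p :+ b :* con 0ℚ)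
                                    refl (p i) (λ′ j) (λ′ j′) ⟩
    p i + λ′ j′ · 0ℚ     ≡⟨ cong (λ w → p i + λ′ j′ · w) (sym v≡0) ⟩
    p i + λ′ j′ · v i    ≡⟨ sym (coord≡ i j′) ⟩
    coord i j′           ∎

  coord-monotone : ∀ i → 0ℚ ℚ.< v i → ∀ {j j′} → λ′ j ℚ.≤ λ′ j′ → coord i j ℚ.≤ coord i j′
  coord-monotone i v>0 {j} {j′} λ≤λ′ = subst₂ ℚ._≤_ (sym (coord≡ i j)) (sym (coord≡ i j′))
    (ℚ.+-monoʳ-≤ (p i) (ℚ.*-monoʳ-≤-nonNeg (v i) {{ℚ.nonNegative (ℚ.<⇒≤ v>0)}} λ≤λ′))

  coord-antitone : ∀ i → v i ℚ.< 0ℚ → ∀ {j j′} → λ′ j ℚ.≤ λ′ j′ → coord i j′ ℚ.≤ coord i j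
  coord-antitone i v<0 {j} {j′} λ≤λ′ = subst₂ ℚ._≤_ (sym (coord≡ i j′)) (sym (coord≡ i j))
    (ℚ.+-monoʳ-≤ (p i) (ℚ.*-monoʳ-≤-nonPos (v i) {{ℚ.nonPositive (ℚ.<⇒≤ v<0)}} λ≤λ′))

  ascending-ends : ∀ i → 0ℚ ℚ.< v i → coord i jmin ≡ 1ℚ × coord i jmax ≡ T
  ascending-ends i v>0 =
    minimum≡1 (λ j → coord-monotone i v>0 (λmin≤ j)) , maximum≡t (λ j → coord-monotone i v>0 (≤λmax j))
    where open DistinctGridValues (coord i) (λ j → grid j i) (coord-injective i (≢-sym (ℚ.<⇒≢ v>0)))

  descending-ends : ∀ i → v i ℚ.< 0ℚ → coord i jmin ≡ T × coord i jmax ≡ 1ℚ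
  descending-ends i v<0 =
    maximum≡t (λ j → coord-antitone i v<0 (λmin≤ j)) , minimum≡1 (λ j → coord-antitone i v<0 (≤λmax j))
    where open DistinctGridValues (coord i) (λ j → grid j i) (coord-injective i (ℚ.<⇒≢ v<0))

  letterOf : ∀ i → Tri (v i ℚ.< 0ℚ) (v i ≡ 0ℚ) (v i ℚ.> 0ℚ) → Letter t
  letterOf i (tri< _ _ _) = moving true
  letterOf i (tri≈ _ _ _) = fixed (coord i jmin) (grid jmin i)
  letterOf i (tri> _ _ _) = moving false

  word : Fin d → Letter t
  word i = letterOf i (ℚ.<-cmp (v i) 0ℚ)

  letterOf-ends : ∀ i sign → coord i jmin ≡ letterOf i sign ⟦ 1ℚ ⟧ × coord i jmax ≡ letterOf i sign ⟦ T ⟧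
  letterOf-ends i (tri< v<0 _ _) = let (jmin↦t , jmax↦1) = descending-ends i v<0 in
    trans jmin↦t (sym (mirror-1 t)) , trans jmax↦1 (sym (mirror-t t))
  letterOf-ends i (tri≈ _ v≡0 _) = refl , coord-constant i v≡0 jmax jmin
  letterOf-ends i (tri> _ _ v>0) = ascending-ends i v>0

  word-ends : ∀ i → coord i jmin ≡ word i ⟦ 1ℚ ⟧ × coord i jmax ≡ word i ⟦ T ⟧
  word-ends i = letterOf-ends i (ℚ.<-cmp (v i) 0ℚ)

  letterOf-moving : ∀ i → v i ≢ 0ℚ → ∀ sign → Σ Bool λ b → letterOf i sign ≡ moving b
  letterOf-moving i _   (tri< _ _ _)   = true , refl
  letterOf-moving i v≢0 (tri≈ _ v≡0 _) = contradiction v≡0 v≢0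
  letterOf-moving i _   (tri> _ _ _)   = false , refl

  movingLetter : Σ (Fin d) λ i → Σ Bool λ b → word i ≡ moving b
  movingLetter =
    let (i₀ , v≢0) = Fin.¬∀⟶∃¬ d (λ i → v i ≡ 0ℚ) (λ i → v i ℚ.≟ 0ℚ) (dir≢0 ℓ) in
    i₀ , letterOf-moving i₀ v≢0 (ℚ.<-cmp (v i₀) 0ℚ)

  1≢T : 1ℚ ≢ T
  1≢T 1≡T with ℕ→ℚ-injective {1} {t} 1≡T
  ... | ()

  ends-distinct : f jmin ≢ f jmax
  ends-distinct fmin≡fmax =
    let (i₀ , b , word≡) = movingLetter in
    1≢T (orient-injective b (subst (λ a → a ⟦ 1ℚ ⟧ ≡ a ⟦ T ⟧) word≡ (begin
      word i₀ ⟦ 1ℚ ⟧  ≡⟨ sym (proj₁ (word-ends i₀)) ⟩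
      coord i₀ jmin   ≡⟨ cong (λ x → lookup x i₀) fmin≡fmax ⟩
      coord i₀ jmax   ≡⟨ proj₂ (word-ends i₀) ⟩
      word i₀ ⟦ T ⟧   ∎)))

  ends-interpolate : ∀ i r → coord i jmin + r · (coord i jmax - coord i jmin) ≡ word i ⟦ 1ℚ + r · (T - 1ℚ) ⟧
  ends-interpolate i r = let (jmin↦1 , jmax↦T) = word-ends i in
    trans (cong₂ (λ a b → a + r · (b - a)) jmin↦1 jmax↦T) (sym (letter-affine (word i) r))

  geometric : GeometricLine t ℓ
  geometric .GeometricLine.word = word
  geometric .GeometricLine.movingLetter = movingLetter
  geometric .GeometricLine.∈L⇒word {x} x∈ℓ =
    let (r , x≡) = ∈L⇒through ℓ ends-distinct (on jmin) (on jmax) x x∈ℓ in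
    1ℚ + r · (T - 1ℚ) , λ i → trans (x≡ i) (ends-interpolate i r)
  geometric .GeometricLine.word⇒∈L {x} {s} x≡ = through⇒∈L ℓ (on jmin) (on jmax) x-through
    where
    instance _ = ℚ.≢-nonZero (p≢q⇒q-p≢0 1≢T)
    r = (s - 1ℚ) ÷ (T - 1ℚ)
    x-through : Through (f jmin) (f jmax) x
    x-through = r , λ i → begin
      lookup x i                                       ≡⟨ x≡ i ⟩
      word i ⟦ s ⟧                                     ≡⟨ cong (word i ⟦_⟧) (sym (a+[c-a]÷[b-a]·[b-a]≡c s 1≢T)) ⟩
      word i ⟦ 1ℚ + r · (T - 1ℚ) ⟧                     ≡⟨ sym (ends-interpolate i r) ⟩
      coord i jmin + r · (coord i jmax - coord i jmin) ∎

gridLine⇒geometric : ∀ {t d} → 2 ≤ t → (ℓ : Line d) → ContainsGridPoints t ℓ → GeometricLine t ℓ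
gridLine⇒geometric (s≤s (s≤s z≤n)) ℓ points = GridLine.geometric ℓ points

∀-⊎-const : ∀ {n} {P : Fin n → Set} {Q : Set} → (∀ i → P i ⊎ Q) → (∀ i → P i) ⊎ Q
∀-⊎-const {zero}  _ = inj₁ λ ()
∀-⊎-const {suc n} h with h Fin.zero | ∀-⊎-const (h ∘ Fin.suc)
... | inj₂ q  | _       = inj₂ q
... | inj₁ _  | inj₂ q  = inj₂ q
... | inj₁ p₀ | inj₁ ps = inj₁ (Fin.∀-cons p₀ ps)

module _ {t d} {ℓ₁ ℓ₂ : Line d} (G₁ : GeometricLine t ℓ₁) (G₂ : GeometricLine t ℓ₂) where
  private
    module G₁ = GeometricLine G₁
    module G₂ = GeometricLine G₂

  agreeing-words⇒SameLine : ∀ σ → (∀ i s → G₁.word i ⟦ s ⟧ ≡ G₂.word i ⟦ orient t σ s ⟧) → SameLine ℓ₁ ℓ₂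
  agreeing-words⇒SameLine σ agree x = to , from
    where
    to : x ∈L ℓ₁ → x ∈L ℓ₂
    to x∈ℓ₁ = let (s , x≡) = G₁.∈L⇒word {x} x∈ℓ₁ in
      G₂.word⇒∈L {x} {orient t σ s} λ i → trans (x≡ i) (agree i s)
    from : x ∈L ℓ₂ → x ∈L ℓ₁
    from x∈ℓ₂ = let (s , x≡) = G₂.∈L⇒word {x} x∈ℓ₂ in
      G₁.word⇒∈L {x} {orient t σ s} λ i → begin
        lookup x i                               ≡⟨ x≡ i ⟩
        G₂.word i ⟦ s ⟧                          ≡⟨ cong (G₂.word i ⟦_⟧) (sym (orient-involutive σ)) ⟩
        G₂.word i ⟦ orient t σ (orient t σ s) ⟧  ≡⟨ sym (agree i (orient t σ s)) ⟩
        G₁.word i ⟦ orient t σ s ⟧               ∎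

  module _ (mirror-fixedPoint-grid : ∀ {q} → q ≡ mirror t q → GridValue t q) where

    letters-agree-or-grid : ∀ (a b : Letter t) σ {u} → a ⟦ u ⟧ ≡ b ⟦ orient t σ u ⟧ →
      (∀ s → a ⟦ s ⟧ ≡ b ⟦ orient t σ s ⟧) ⊎ GridValue t u
    letters-agree-or-grid (fixed c _) (fixed c′ _) σ c≡c′ = inj₁ λ _ → c≡c′
    letters-agree-or-grid (fixed c g) (moving b)  σ {u} e =
      inj₂ (orient⁻¹-grid (b xor σ) (trans (sym (orient-xor b σ u)) (sym e)) g)
    letters-agree-or-grid (moving b)  (fixed c g) σ e = inj₂ (orient⁻¹-grid b e g)
    letters-agree-or-grid (moving b)  (moving b′) σ {u} e with b Bool.≟ b′ xor σ
    ... | yes refl = inj₁ λ s → sym (orient-xor b′ σ s)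
    ... | no  b≢   = inj₂ (mirror-fixedPoint-grid (orient-fixedPoint b≢ (trans e (orient-xor b′ σ u))))

    pivot-relation : ∀ {b u w} (a : Letter t) → orient t b u ≡ a ⟦ w ⟧ →
      GridValue t u ⊎ Σ Bool λ σ → w ≡ orient t σ u
    pivot-relation {b} (fixed c g) e = inj₁ (orient⁻¹-grid b e g)
    pivot-relation {b} {u} {w} (moving b′) e = inj₂ (b′ xor b , (begin
      w                           ≡⟨ sym (orient-involutive b′) ⟩
      orient t b′ (orient t b′ w) ≡⟨ cong (orient t b′) (sym e) ⟩
      orient t b′ (orient t b u)  ≡⟨ orient-xor b′ b u ⟩
      orient t (b′ xor b) u       ∎))

    common-parameter-grid : ¬ SameLine ℓ₁ ℓ₂ → ∀ {x u w} →
      G₁.word ⟦ u ⟧≡ x → G₂.word ⟦ w ⟧≡ x → GridValue t u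
    common-parameter-grid ¬same {x} {u} {w} x≡₁ x≡₂
      with (i₀ , b , word≡) ← G₁.movingLetter
      with pivot-relation {b} {u} {w} (G₂.word i₀)
             (subst (λ a → a ⟦ u ⟧ ≡ G₂.word i₀ ⟦ w ⟧) word≡ (trans (sym (x≡₁ i₀)) (x≡₂ i₀)))
    ... | inj₁ u-grid     = u-grid
    ... | inj₂ (σ , refl) =
      [ (λ agree → contradiction (agreeing-words⇒SameLine σ agree) ¬same) , id ]′
      (∀-⊎-const λ i → letters-agree-or-grid (G₁.word i) (G₂.word i) σ (trans (sym (x≡₁ i)) (x≡₂ i)))

    geometric-lines-meet-in-grid : ¬ SameLine ℓ₁ ℓ₂ → (x : Point d) → x ∈L ℓ₁ → x ∈L ℓ₂ → InGrid t x
    geometric-lines-meet-in-grid ¬same x x∈ℓ₁ x∈ℓ₂ i =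
      let (u , x≡₁) = G₁.∈L⇒word {x} x∈ℓ₁
          (w , x≡₂) = G₂.∈L⇒word {x} x∈ℓ₂
          u-grid = common-parameter-grid ¬same {x} {u} {w} x≡₁ x≡₂
      in subst (GridValue t) (sym (x≡₁ i)) (letter-grid (G₁.word i) u-grid)

k≤2k∸1 : ∀ {k} → 1 ≤ k → k ≤ 2 * k ∸ 1
k≤2k∸1 {suc a} _ rewrite ℕ.+-identityʳ a = ℕ.m≤n+m (suc a) a

odd-mirror-fixedPoint-grid : ∀ {k q} → 1 ≤ k → q ≡ mirror (2 * k ∸ 1) q → GridValue (2 * k ∸ 1) q
odd-mirror-fixedPoint-grid {k} {q} 1≤k q≡mirror = k , 1≤k , k≤2k∸1 1≤k , (begin
  q                            ≡⟨ solve 1 (λ q → q := con ½ :* (q :+ q)) refl q ⟩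
  ½ · (q + q)                  ≡⟨ cong (λ y → ½ · (q + y)) q≡mirror ⟩
  ½ · (q + mirror t q)         ≡⟨ solve 2 (λ q T → con ½ :* (q :+ (con 1ℚ :+ T :- q)) := con ½ :* (con 1ℚ :+ T))
                                          refl q (ℕ→ℚ t) ⟩
  ½ · (1ℚ + ℕ→ℚ t)             ≡⟨ cong (½ ·_) (sym (ℕ→ℚ-suc t)) ⟩
  ½ · ℕ→ℚ (suc t)              ≡⟨ cong (λ m → ½ · ℕ→ℚ m) (ℕ.m+[n∸m]≡n 1≤2k) ⟩
  ½ · ℕ→ℚ (2 * k)              ≡⟨ cong (½ ·_) (ℕ→ℚ-2* k) ⟩
  ½ · (ℕ→ℚ k + ℕ→ℚ k)          ≡⟨ solve 1 (λ K → con ½ :* (K :+ K) := K) refl (ℕ→ℚ k) ⟩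
  ℕ→ℚ k                        ∎)
  where
  t = 2 * k ∸ 1
  1≤2k : 1 ≤ 2 * k
  1≤2k = ℕ.≤-trans 1≤k (ℕ.m≤m+n k (k ℕ.+ 0))

gridValue-1 : ∀ {q} → GridValue 1 q → q ≡ 1ℚ
gridValue-1 (suc zero    , _ , _       , q≡1) = q≡1
gridValue-1 (suc (suc _) , _ , s≤s () , _)

unit-grid-lines-meet-in-grid : ∀ {d} (ℓ₁ ℓ₂ : Line d) → ContainsGridPoints 1 ℓ₁ → ContainsGridPoints 1 ℓ₂ →
  ¬ SameLine ℓ₁ ℓ₂ → (x : Point d) → x ∈L ℓ₁ → x ∈L ℓ₂ → InGrid 1 x
unit-grid-lines-meet-in-grid ℓ₁ ℓ₂ (f₁ , _ , on₁) (f₂ , _ , on₂) ¬same x x∈ℓ₁ x∈ℓ₂ =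
  subst (InGrid 1) (sym x≡g₁) (proj₁ (on₁ Fin.zero))
  where
  g₁ g₂ : Point _
  g₁ = f₁ Fin.zero
  g₂ = f₂ Fin.zero
  g₁≡g₂ : g₁ ≡ g₂
  g₁≡g₂ = Pointwise-≡⇒≡ (ext λ i →
    trans (gridValue-1 (proj₁ (on₁ Fin.zero) i)) (sym (gridValue-1 (proj₁ (on₂ Fin.zero) i))))
  x≡g₁ : x ≡ g₁
  x≡g₁ = lines-meet-at-most-once ℓ₁ ℓ₂ ¬same x g₁ x∈ℓ₁ x∈ℓ₂
    (proj₂ (on₁ Fin.zero)) (subst (_∈L ℓ₂) (sym g₁≡g₂) (proj₂ (on₂ Fin.zero)))

mainTheorem7 : (d k : ℕ) → 1 ≤ k → (ℓ₁ ℓ₂ : Line d) →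
               ContainsGridPoints (2 * k ∸ 1) ℓ₁ → ContainsGridPoints (2 * k ∸ 1) ℓ₂ →
               ¬ SameLine ℓ₁ ℓ₂ →
               ((x : Point d) → x ∈L ℓ₁ → x ∈L ℓ₂ → InGrid (2 * k ∸ 1) x)
               × ((x y : Point d) → x ∈L ℓ₁ → x ∈L ℓ₂ → y ∈L ℓ₁ → y ∈L ℓ₂ → x ≡ y)
mainTheorem7 d (suc zero) _ ℓ₁ ℓ₂ C₁ C₂ ¬same =
  unit-grid-lines-meet-in-grid ℓ₁ ℓ₂ C₁ C₂ ¬same , lines-meet-at-most-once ℓ₁ ℓ₂ ¬same
mainTheorem7 d k@(suc (suc _)) 1≤k ℓ₁ ℓ₂ C₁ C₂ ¬same =
  geometric-lines-meet-in-grid G₁ G₂ (odd-mirror-fixedPoint-grid 1≤k) ¬same ,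
  lines-meet-at-most-once ℓ₁ ℓ₂ ¬same
  where
  2≤t : 2 ≤ 2 * k ∸ 1
  2≤t = ℕ.≤-trans (s≤s (s≤s z≤n)) (k≤2k∸1 1≤k)
  G₁ = gridLine⇒geometric 2≤t ℓ₁ C₁
  G₂ = gridLine⇒geometric 2≤t ℓ₂ C₂
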